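{- Let $r$ be a power of the prime $p$, and consider a Desarguesian net of order $r$ and degree $m \ge 1$, with collinearity graph $\Gamma$. Let $L$ be a line of the net and $x$ a point not on $L$. Then the clique $\{x\} \cup (x^\perp \cap L)$ of $\Gamma$ is contained in a unique maximal clique $C_{x,L}$ of $\Gamma$. Moreover, when $p \nmid (m-1)$: if $\{x\} \cup (x^\perp \cap L)$ is not a maximal clique, then there is a unique line $M$ of the net passing through $x$ such that $C_{x,L} \subseteq L \cup M$.
   Context: A Desarguesian net of order $r$ and degree $m$ ($0\le m\le r+1$) is obtained from the Desarguesian affine plane of order $r$ by keeping $m$ parallel classes. Concretely: identify the point set with $\mathbb{F}_{r^2}$ (a 2-dimensional $\mathbb{F}_r$-vector space); fix a set $S\subseteq \mathbb{F}_{r^2}^*$ which is a union of $m$ cosets of $\mathbb{F}_r^*$ in $\mathbb{F}_{r^2}^*$ (the $m$ chosen directions). The lines of the net are the sets $a + d\,\mathbb{F}_r$ with $a \in \mathbb{F}_{r^2}$, $d \in S$. The collinearity graph $\Gamma$ has vertex set $\mathbb{F}_{r^2}$, two distinct vertices being adjacent iff their difference lies in $S$ (equivalently, iff they lie on a common line of the net). For a vertex $y$, $y^\perp$ denotes $\{y\}$ together with the set of neighbours of $y$. A clique is a set of pairwise adjacent vertices. -}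

module Defs where

open import Level using (0ℓ)
open import Data.Nat as ℕ using (ℕ; suc; _^_)
open import Data.Fin using (Fin)
open import Data.Product using (Σ; _×_; _,_; ∃)
open import Data.Sum using (_⊎_)
open import Data.List using (List; length)
open import Data.List.Membership.Propositional using (_∈_)
open import Data.List.Relation.Unary.Unique.Propositional using (Unique)
open import Relation.Nullary using (¬_)
open import Relation.Binary.PropositionalEquality using (_≡_; _≢_)
open import Relation.Binary.Definitions using (DecidableEquality)
open import Relation.Unary using (Pred; _⊆_; _∪_)
open import Algebra.Structures using (IsCommutativeRing)

record FiniteField : Set₁ where
  infixl 6 _+_
  infixl 7 _*_
  field
    Carrier : Set
    _+_ _*_ : Carrier → Carrier → Carrier
    -_      : Carrier → Carrier
    0# 1#   : Carrier
    isCommutativeRing : IsCommutativeRing _≡_ _+_ _*_ -_ 0# 1#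
    0≢1     : 0# ≢ 1#
    inverse : ∀ x → x ≢ 0# → Σ Carrier (λ y → x * y ≡ 1#)
    _≟_     : DecidableEquality Carrier
    elements : List Carrier
    elements-unique : Unique elements
    elements-complete : ∀ x → x ∈ elements

  order : ℕ
  order = length elements

-- The Desarguesian net: point set = 2-dimensional vector space K² over
-- the field K of order r (≅ F_{r²} as an F_r-vector space).
module Net (K : FiniteField) where
  open FiniteField K

  Point : Set
  Point = Carrier × Carrier

  _⊕_ : Point → Point → Point
  (a , b) ⊕ (c , d) = (a + c , b + d)

  _⊖_ : Point → Point → Point
  (a , b) ⊖ (c , d) = (a + (- c) , b + (- d))

  _·_ : Carrier → Point → Point
  t · (a , b) = (t * a , t * b)

  𝟎 : Point
  𝟎 = (0# , 0#)

  -- m directions: nonzero vectors, pairwise non-proportional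
  -- (i.e. m distinct cosets of F_r^* in F_{r²}^*, i.e. m parallel classes).
  record Directions (m : ℕ) : Set where
    field
      dir : Fin m → Point
      dir-nonzero : ∀ i → dir i ≢ 𝟎
      dir-distinct : ∀ i j → i ≢ j → ¬ (Σ Carrier λ t → dir j ≡ t · dir i)

  module _ {m : ℕ} (D : Directions m) where
    open Directions D

    Adj : Point → Point → Set
    Adj u v = u ≢ v × Σ (Fin m) λ i → Σ Carrier λ t → v ⊖ u ≡ t · dir i

    record Line : Set where
      constructor line
      field
        base : Point
        idx  : Fin m

    OnLine : Line → Pred Point 0ℓ
    OnLine (line a i) z = Σ Carrier λ t → z ≡ a ⊕ (t · dir i)

    _≐_ : Pred Point 0ℓ → Pred Point 0ℓ → Set
    A ≐ B = (A ⊆ B) × (B ⊆ A)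

    IsClique : Pred Point 0ℓ → Set
    IsClique C = ∀ u v → C u → C v → u ≢ v → Adj u v

    IsMaximalClique : Pred Point 0ℓ → Set₁
    IsMaximalClique C = IsClique C × (∀ E → IsClique E → C ⊆ E → E ⊆ C)

    StarOn : Point → Line → Pred Point 0ℓ
    StarOn x L z = z ≡ x ⊎ (Adj x z × OnLine L z)

module Submission where

-- Choose affine coordinates (A , B) in which L is the line B = 0 and x = (0 , 1), and call s a
-- slope when the direction of (s , -1) is one of the net, so that x^⊥ ∩ L consists of the points
-- (s , 0) with s a slope.  Every clique containing S = {x} ∪ (x^⊥ ∩ L) lies in the common
-- neighbourhood C of S, so it suffices to show that C is a clique.  A point z = (A , B) of C ∖ S
-- has B ≢ 0, and its adjacency to the points (s , 0) of S says that the affine map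
-- σ_z : s ↦ A + B s permutes the set U of slopes; its adjacency to x says that σ_z is a
-- translation or that its fixed point, the slope of the line xz, lies in U.  The affine maps
-- permuting U form a group whose commutators are translations by periods of U; hence the fixed
-- points of two non-translations in it differ by a period.  For u, v ∈ C ∖ S with uv not parallel
-- to L, the slope of uv is the fixed point of σ_u⁻¹ σ_v, and comparing it with the fixed point of
-- whichever of σ_u, σ_v is not a translation shows that it lies in U: u and v are adjacent.
-- A nonzero period n of U gives |U| · n = 0 in K, and |U| = m - 1.  So when p ∤ m - 1, U has no
-- nonzero period; then no σ_z with z ∈ C ∖ S is a translation (it would be the identity, z = x),
-- and all of them have one common fixed point Q, so C ∖ S lies on the line through x and (Q , 0).

open import Defs
open import Level using (0ℓ)
open import Data.Nat using (ℕ; _^_; _≥_; _∸_)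
open import Data.Nat.Divisibility using (_∣_)
open import Data.Nat.Primality using (Prime)
open import Data.Product using (Σ; _×_)
open import Relation.Nullary using (¬_)
open import Relation.Binary.PropositionalEquality using (_≡_)
open import Relation.Unary using (Pred; _⊆_; _∪_)

open import Data.Nat as ℕ using (zero; suc)
import Data.Nat.Properties as ℕ
open import Data.Nat.GeneralisedArithmetic using (fold; fold-+)
open import Data.Nat.Primality using (prime⇒irreducible)
open import Data.Nat.Coprimality using (Coprime; coprime-Bézout)
open import Data.Nat.GCD using (module Bézout)
open import Data.Integer as ℤ using (ℤ; -[1+_]; 0ℤ; 1ℤ)
import Data.Integer.Properties as ℤ
open import Data.Fin as Fin using (Fin; toℕ; punchIn; punchOut)
import Data.Fin.Properties as Fin
open import Data.Fin.Permutation using (permutation)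
open import Data.Product using (_,_; proj₁; proj₂; ∃; swap; map₂)
open import Data.Product.Properties using (≡-dec)
open import Data.Sum using (_⊎_; inj₁; inj₂; [_,_]′)
open import Data.Empty using (⊥-elim)
open import Data.Maybe using (Maybe; just; nothing)
open import Data.List using (List; _∷_; length; lookup; cartesianProduct)
import Data.List.Relation.Unary.Any as Any
import Data.List.Relation.Unary.All as All
open import Data.List.Relation.Unary.Any.Properties using (lookup-index)
open import Data.List.Relation.Unary.AllPairs using (_∷_)
open import Data.List.Relation.Unary.Unique.Propositional using (Unique)
open import Data.List.Membership.Propositional using (_∈_)
open import Data.List.Membership.Propositional.Properties using (∈-lookup; ∈-cartesianProduct⁺)
open import Function.Base using (_∘_; id)
open import Function.Definitions using (Injective)
open import Algebra.Bundles using (CommutativeRing)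
open import Algebra.Solver.Ring.AlmostCommutativeRing
  using (fromCommutativeRing; _-Raw-AlmostCommutative⟶_)
open import Relation.Nullary using (Dec; yes; no; ¬?)
open import Relation.Nullary.Decidable using (_×-dec_; _⊎-dec_; _→-dec_; map′)
open import Relation.Unary using (Decidable)
open import Relation.Binary.Definitions using (DecidableEquality)
open import Relation.Binary.PropositionalEquality
  using (_≢_; refl; sym; trans; cong; cong₂; subst; module ≡-Reasoning)

module RingSolver {c ℓ} (R : CommutativeRing c ℓ) where
  open CommutativeRing R hiding (refl; sym; trans; reflexive)
  private module ≈ = CommutativeRing R using (refl; sym; trans; reflexive)
  open import Algebra.Properties.Ring ring using (-0#≈0#; -‿involutive; -‿distribˡ-*; -‿distribʳ-*)
  open import Algebra.Properties.AbelianGroup +-abelianGroup using (⁻¹-∙-comm)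
  open import Algebra.Properties.Semiring.Mult.TCOptimised semiring
    using (×-homo-+; ×1-homo-*) renaming (_×_ to _×′_)
  open import Relation.Binary.Reasoning.Setoid setoid

  fromℤ : ℤ → Carrier
  fromℤ (ℤ.+ n)  = n ×′ 1#
  fromℤ -[1+ n ] = - (suc n ×′ 1#)

  private
    1+a-[1+b]≈a-b : ∀ a b → (1# + a) + - (1# + b) ≈ a + - b
    1+a-[1+b]≈a-b a b = begin
      (1# + a) + - (1# + b)    ≈⟨ +-congˡ (≈.sym (⁻¹-∙-comm 1# b)) ⟩
      (1# + a) + (- 1# + - b)  ≈⟨ +-assoc 1# a _ ⟩
      1# + (a + (- 1# + - b))  ≈⟨ +-congˡ (≈.sym (+-assoc a (- 1#) (- b))) ⟩
      1# + ((a + - 1#) + - b)  ≈⟨ +-congˡ (+-congʳ (+-comm a (- 1#))) ⟩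
      1# + ((- 1# + a) + - b)  ≈⟨ +-congˡ (+-assoc (- 1#) a (- b)) ⟩
      1# + (- 1# + (a + - b))  ≈⟨ ≈.sym (+-assoc 1# (- 1#) _) ⟩
      (1# + - 1#) + (a + - b)  ≈⟨ +-congʳ (-‿inverseʳ 1#) ⟩
      0# + (a + - b)           ≈⟨ +-identityˡ _ ⟩
      a + - b                  ∎

  fromℤ-⊖ : ∀ m n → fromℤ (m ℤ.⊖ n) ≈ m ×′ 1# + - (n ×′ 1#)
  fromℤ-⊖ m       zero    = begin
    fromℤ (m ℤ.⊖ 0)                     ≡⟨ cong fromℤ (ℤ.⊖-≥ {m} ℕ.z≤n) ⟩
    m ×′ 1#                             ≈⟨ ≈.sym (+-identityʳ _) ⟩
    m ×′ 1# + 0#                        ≈⟨ +-congˡ (≈.sym -0#≈0#) ⟩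
    m ×′ 1# + - 0#                      ∎
  fromℤ-⊖ zero    (suc n) = ≈.sym (+-identityˡ _)
  fromℤ-⊖ (suc m) (suc n) = begin
    fromℤ (suc m ℤ.⊖ suc n)             ≡⟨ cong fromℤ (ℤ.[1+m]⊖[1+n]≡m⊖n m n) ⟩
    fromℤ (m ℤ.⊖ n)                     ≈⟨ fromℤ-⊖ m n ⟩
    m ×′ 1# + - (n ×′ 1#)               ≈⟨ 1+a-[1+b]≈a-b _ _ ⟨
    (1# + m ×′ 1#) + - (1# + n ×′ 1#)   ≈⟨ +-cong (×-homo-+ 1# 1 m) (-‿cong (×-homo-+ 1# 1 n)) ⟨
    suc m ×′ 1# + - (suc n ×′ 1#)       ∎

  fromℤ-+ : ∀ i j → fromℤ (i ℤ.+ j) ≈ fromℤ i + fromℤ j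
  fromℤ-+ (ℤ.+ a)  (ℤ.+ b)  = ×-homo-+ 1# a b
  fromℤ-+ (ℤ.+ a)  -[1+ b ] = fromℤ-⊖ a (suc b)
  fromℤ-+ -[1+ a ] (ℤ.+ b)  = ≈.trans (fromℤ-⊖ b (suc a)) (+-comm _ _)
  fromℤ-+ -[1+ a ] -[1+ b ] = begin
    - (suc (suc a ℕ.+ b) ×′ 1#)         ≡⟨ cong (λ n → - (n ×′ 1#)) (ℕ.+-suc (suc a) b) ⟨
    - ((suc a ℕ.+ suc b) ×′ 1#)         ≈⟨ -‿cong (×-homo-+ 1# (suc a) (suc b)) ⟩
    - (suc a ×′ 1# + suc b ×′ 1#)       ≈⟨ ⁻¹-∙-comm _ _ ⟨
    - (suc a ×′ 1#) + - (suc b ×′ 1#)   ∎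

  fromℤ-neg : ∀ i → fromℤ (ℤ.- i) ≈ - fromℤ i
  fromℤ-neg (ℤ.+ zero)  = ≈.sym -0#≈0#
  fromℤ-neg (ℤ.+ suc n) = ≈.refl
  fromℤ-neg -[1+ n ]    = ≈.sym (-‿involutive _)

  fromℤ-* : ∀ i j → fromℤ (i ℤ.* j) ≈ fromℤ i * fromℤ j
  fromℤ-* (ℤ.+ a)  (ℤ.+ b)  = ≈.trans (≈.reflexive (cong fromℤ (ℤ.+◃n≡+n (a ℕ.* b)))) (×1-homo-* a b)
  fromℤ-* (ℤ.+ a)  -[1+ b ] = begin
    fromℤ (ℤ.+ a ℤ.* -[1+ b ])          ≡⟨ cong fromℤ (ℤ.-◃n≡-n (a ℕ.* suc b)) ⟩
    fromℤ (ℤ.- ℤ.+ (a ℕ.* suc b))       ≈⟨ fromℤ-neg (ℤ.+ (a ℕ.* suc b)) ⟩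
    - ((a ℕ.* suc b) ×′ 1#)             ≈⟨ -‿cong (×1-homo-* a (suc b)) ⟩
    - (a ×′ 1# * suc b ×′ 1#)           ≈⟨ -‿distribʳ-* _ _ ⟩
    a ×′ 1# * - (suc b ×′ 1#)           ∎
  fromℤ-* -[1+ a ] (ℤ.+ b)  = begin
    fromℤ (-[1+ a ] ℤ.* ℤ.+ b)          ≡⟨ cong fromℤ (ℤ.-◃n≡-n (suc a ℕ.* b)) ⟩
    fromℤ (ℤ.- ℤ.+ (suc a ℕ.* b))       ≈⟨ fromℤ-neg (ℤ.+ (suc a ℕ.* b)) ⟩
    - ((suc a ℕ.* b) ×′ 1#)             ≈⟨ -‿cong (×1-homo-* (suc a) b) ⟩
    - (suc a ×′ 1# * b ×′ 1#)           ≈⟨ -‿distribˡ-* _ _ ⟩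
    - (suc a ×′ 1#) * b ×′ 1#           ∎
  fromℤ-* -[1+ a ] -[1+ b ] = begin
    (suc a ℕ.* suc b) ×′ 1#             ≈⟨ ×1-homo-* (suc a) (suc b) ⟩
    suc a ×′ 1# * suc b ×′ 1#           ≈⟨ -‿involutive _ ⟨
    - - (suc a ×′ 1# * suc b ×′ 1#)     ≈⟨ -‿cong (-‿distribˡ-* _ _) ⟩
    - (- (suc a ×′ 1#) * suc b ×′ 1#)   ≈⟨ -‿distribʳ-* _ _ ⟩
    - (suc a ×′ 1#) * - (suc b ×′ 1#)   ∎

  private
    coefficients≟ : ∀ i j → Maybe (fromℤ i ≈ fromℤ j)
    coefficients≟ i j with i ℤ.≟ j
    ... | yes refl = just ≈.refl
    ... | no _     = nothing

    morphism : ℤ.+-*-rawRing -Raw-AlmostCommutative⟶ fromCommutativeRing R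
    morphism = record
      { ⟦_⟧ = fromℤ ; +-homo = fromℤ-+ ; *-homo = fromℤ-* ; -‿homo = fromℤ-neg
      ; 0-homo = ≈.refl ; 1-homo = ≈.refl }

  open import Algebra.Solver.Ring ℤ.+-*-rawRing (fromCommutativeRing R) morphism coefficients≟ public

module Enumeration {a} {A : Set a} (elements : List A) (complete : ∀ x → x ∈ elements) where

  module _ {p} {P : Pred A p} (P? : Decidable P) where

    search : Dec (∃ P)
    search = map′ Any.satisfied (λ (x , px) → Any.map (λ { refl → px }) (complete x))
                  (Any.any? P? elements)

    universal : Dec (∀ x → P x)
    universal = map′ (λ all x → All.lookup all (complete x)) (λ ∀P → All.tabulate λ {x} _ → ∀P x)
                     (All.all? P? elements)

  module _ {f : A → A} (f-injective : Injective _≡_ _≡_ f) where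

    private
      index : A → Fin (length elements)
      index x = Any.index (complete x)

      index-injective : Injective _≡_ _≡_ index
      index-injective {x} {y} eq = begin
        x                           ≡⟨ lookup-index (complete x) ⟩
        lookup elements (index x)   ≡⟨ cong (lookup elements) eq ⟩
        lookup elements (index y)   ≡⟨ lookup-index (complete y) ⟨
        y                           ∎
        where open ≡-Reasoning

      fold-injective : ∀ n → Injective _≡_ _≡_ (λ u → fold u f n)
      fold-injective zero    eq = eq
      fold-injective (suc n) eq = fold-injective n (f-injective eq)

    orbit-closes : ∀ u → ∃ λ k → fold u f (suc k) ≡ u
    orbit-closes u with i , j , i<j , same ← Fin.pigeonhole (ℕ.n<1+n _) (λ i → index (fold u f (toℕ i)))
                   with k , i+1+k≡j ← ℕ.m≤n⇒∃[o]m+o≡n i<j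
      = k , sym (fold-injective (toℕ i) (begin
          fold u f (toℕ i)                    ≡⟨ index-injective same ⟩
          fold u f (toℕ j)                    ≡⟨ cong (fold u f) (trans (sym i+1+k≡j) (sym (ℕ.+-suc _ k))) ⟩
          fold u f (toℕ i ℕ.+ suc k)          ≡⟨ fold-+ u f (toℕ i) ⟩
          fold (fold u f (suc k)) f (toℕ i)   ∎))
      where open ≡-Reasoning

    module _ {ℓ} (P : Pred A ℓ) (f-preserves : ∀ {u} → P u → P (f u)) where

      private
        fold-preserves : ∀ {u} n → P u → P (fold u f n)
        fold-preserves zero    Pu = Pu
        fold-preserves (suc n) Pu = f-preserves (fold-preserves n Pu)

      preimage : ∀ {u} → P u → ∃ λ v → P v × f v ≡ u
      preimage {u} Pu with k , fᵏ⁺¹u≡u ← orbit-closes u = fold u f k , fold-preserves k Pu , fᵏ⁺¹u≡u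

      inverse-preserves : ∀ {g : A → A} → (∀ v → f (g v) ≡ v) → ∀ {u} → P u → P (g u)
      inverse-preserves {g} f∘g≗id {u} Pu with v , Pv , fv≡u ← preimage Pu =
        subst P (f-injective (trans fv≡u (sym (f∘g≗id u)))) Pv

Unique⇒lookup-injective : ∀ {a} {A : Set a} {xs : List A} → Unique xs → Injective _≡_ _≡_ (lookup xs)
Unique⇒lookup-injective {xs = x ∷ xs} (x∉xs ∷ _) {Fin.zero}  {Fin.zero}  eq = refl
Unique⇒lookup-injective {xs = x ∷ xs} (x∉xs ∷ _) {Fin.zero}  {Fin.suc l} eq =
  ⊥-elim (All.lookup x∉xs (∈-lookup l) eq)
Unique⇒lookup-injective {xs = x ∷ xs} (x∉xs ∷ _) {Fin.suc k} {Fin.zero}  eq =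
  ⊥-elim (All.lookup x∉xs (∈-lookup k) (sym eq))
Unique⇒lookup-injective {xs = x ∷ xs} (_ ∷ unique) {Fin.suc k} {Fin.suc l} eq =
  cong Fin.suc (Unique⇒lookup-injective unique eq)

prime∤⇒coprime : ∀ {p m} → Prime p → ¬ p ∣ m → Coprime p m
prime∤⇒coprime p-prime p∤m (d∣p , d∣m) with prime⇒irreducible p-prime d∣p
... | inj₁ d≡1  = d≡1
... | inj₂ refl = ⊥-elim (p∤m d∣m)

module FieldTheory (K : FiniteField) where
  open FiniteField K public using (_≟_; 0≢1; elements; elements-complete; order)
  open FiniteField K using (isCommutativeRing; inverse)

  commutativeRing : CommutativeRing 0ℓ 0ℓ
  commutativeRing = record { isCommutativeRing = isCommutativeRing }

  open CommutativeRing commutativeRing public hiding (refl; sym; trans; reflexive)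
  open RingSolver commutativeRing public using (solve; con; _:+_; _:*_; :-_; _:-_; _:=_)
  open Enumeration elements elements-complete public
  open import Algebra.Properties.Group +-group using (x∙y⁻¹≈ε⇒x≈y; ∙-cancelˡ; ∙-cancelʳ)
  open import Algebra.Properties.Ring ring public using (-‿involutive) renaming (-0#≈0# to -0#≡0#)

  infix 25 _⁻¹
  _⁻¹ : Carrier → Carrier
  x ⁻¹ with x ≟ 0#
  ... | yes _  = 0#
  ... | no x≢0 = proj₁ (inverse x x≢0)

  x*x⁻¹≡1 : ∀ {x} → x ≢ 0# → x * x ⁻¹ ≡ 1#
  x*x⁻¹≡1 {x} x≢0 with x ≟ 0#
  ... | yes x≡0  = ⊥-elim (x≢0 x≡0)
  ... | no  x≢0′ = proj₂ (inverse x x≢0′)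

  x*[y*x⁻¹]≡y : ∀ {x} → x ≢ 0# → ∀ y → x * (y * x ⁻¹) ≡ y
  x*[y*x⁻¹]≡y {x} x≢0 y = begin
    x * (y * x ⁻¹)   ≡⟨ solve 3 (λ x y x⁻¹ → x :* (y :* x⁻¹) := y :* (x :* x⁻¹)) refl x y (x ⁻¹) ⟩
    y * (x * x ⁻¹)   ≡⟨ cong (y *_) (x*x⁻¹≡1 x≢0) ⟩
    y * 1#           ≡⟨ *-identityʳ y ⟩
    y                ∎
    where open ≡-Reasoning

  x⁻¹*[x*y]≡y : ∀ {x} → x ≢ 0# → ∀ y → x ⁻¹ * (x * y) ≡ y
  x⁻¹*[x*y]≡y {x} x≢0 y =
    trans (solve 3 (λ x y x⁻¹ → x⁻¹ :* (x :* y) := x :* (y :* x⁻¹)) refl x y (x ⁻¹)) (x*[y*x⁻¹]≡y x≢0 y)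

  1≢0 : 1# ≢ 0#
  1≢0 = 0≢1 ∘ sym

  -x≡0⇒x≡0 : ∀ {x} → - x ≡ 0# → x ≡ 0#
  -x≡0⇒x≡0 {x} -x≡0 = trans (sym (-‿involutive x)) (trans (cong -_ -x≡0) -0#≡0#)

  x-y≡0⇒x≡y : ∀ {x y} → x - y ≡ 0# → x ≡ y
  x-y≡0⇒x≡y = x∙y⁻¹≈ε⇒x≈y _ _

  +-cancelˡ : ∀ n → Injective _≡_ _≡_ (n +_)
  +-cancelˡ n = ∙-cancelˡ n _ _

  +-cancelʳ : ∀ n → Injective _≡_ _≡_ (_+ n)
  +-cancelʳ n = ∙-cancelʳ n _ _

  x*y≡0⇒y≡0 : ∀ {x y} → x ≢ 0# → x * y ≡ 0# → y ≡ 0#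
  x*y≡0⇒y≡0 {x} {y} x≢0 xy≡0 = trans (sym (x⁻¹*[x*y]≡y x≢0 y)) (trans (cong (x ⁻¹ *_) xy≡0) (zeroʳ (x ⁻¹)))

  *-cancelˡ : ∀ {x} → x ≢ 0# → Injective _≡_ _≡_ (x *_)
  *-cancelˡ {x} x≢0 {y} {z} xy≡xz = x-y≡0⇒x≡y (x*y≡0⇒y≡0 x≢0 (begin
    x * (y - z)     ≡⟨ solve 3 (λ x y z → x :* (y :- z) := x :* y :- x :* z) refl x y z ⟩
    x * y - x * z   ≡⟨ cong (_- x * z) xy≡xz ⟩
    x * z - x * z   ≡⟨ -‿inverseʳ (x * z) ⟩
    0#              ∎))
    where open ≡-Reasoning

  *-≢0 : ∀ {x y} → x ≢ 0# → y ≢ 0# → x * y ≢ 0#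
  *-≢0 x≢0 y≢0 = y≢0 ∘ x*y≡0⇒y≡0 x≢0

  ⁻¹-≢0 : ∀ {x} → x ≢ 0# → x ⁻¹ ≢ 0#
  ⁻¹-≢0 {x} x≢0 x⁻¹≡0 = 1≢0 (trans (sym (x*x⁻¹≡1 x≢0)) (trans (cong (x *_) x⁻¹≡0) (zeroʳ x)))

module Characteristic (K : FiniteField) where
  open FieldTheory K
  open FiniteField K using (elements-unique)
  open import Algebra.Properties.Semiring.Mult semiring public
    using (×1-homo-*; ×-assoc-*) renaming (_×_ to _×′_)
  open import Algebra.Properties.CommutativeMonoid.Sum +-commutativeMonoid
    using (sum; sum-permute; ∑-distrib-+; sum-cong-≗; sum-replicate)

  module _ {s} {v : Fin s → Carrier} (v-injective : Injective _≡_ _≡_ v) {n : Carrier} where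

    size×shift≡0 : (∀ k → ∃ λ l → v l ≡ v k + n) → (∀ k → ∃ λ l → v l ≡ v k - n) → s ×′ n ≡ 0#
    size×shift≡0 up down = begin
      s ×′ n                   ≡⟨ solve 2 (λ Σv sn → sn := Σv :+ sn :- Σv) refl (sum v) (s ×′ n) ⟩
      sum v + s ×′ n - sum v   ≡⟨ cong (_- sum v) shifted-sum ⟨
      sum v - sum v            ≡⟨ -‿inverseʳ (sum v) ⟩
      0#                       ∎
      where
      open ≡-Reasoning
      π π⁻¹ : Fin s → Fin s
      π   = proj₁ ∘ up
      π⁻¹ = proj₁ ∘ down
      π∘π⁻¹≗id : ∀ k → π (π⁻¹ k) ≡ k
      π∘π⁻¹≗id k = v-injective (trans (proj₂ (up (π⁻¹ k))) (trans (cong (_+ n) (proj₂ (down k)))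
                     (solve 2 (λ vk n → vk :- n :+ n := vk) refl (v k) n)))
      π⁻¹∘π≗id : ∀ k → π⁻¹ (π k) ≡ k
      π⁻¹∘π≗id k = v-injective (trans (proj₂ (down (π k))) (trans (cong (_- n) (proj₂ (up k)))
                     (solve 2 (λ vk n → vk :+ n :- n := vk) refl (v k) n)))
      shifted-sum : sum v ≡ sum v + s ×′ n
      shifted-sum = begin
        sum v                       ≡⟨ sum-permute v (permutation π π⁻¹ π∘π⁻¹≗id π⁻¹∘π≗id) ⟩
        sum (v ∘ π)                 ≡⟨ sum-cong-≗ (proj₂ ∘ up) ⟩
        sum (λ k → v k + n)         ≡⟨ ∑-distrib-+ v (λ _ → n) ⟩
        sum v + sum {s} (λ _ → n)   ≡⟨ cong (sum v +_) (sum-replicate s) ⟩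
        sum v + s ×′ n              ∎

  order×1≡0 : order ×′ 1# ≡ 0#
  order×1≡0 = size×shift≡0 (Unique⇒lookup-injective elements-unique) (λ _ → listed (_ + 1#)) (λ _ → listed (_ - 1#))
    where
    listed : ∀ y → ∃ λ l → lookup elements l ≡ y
    listed y = Any.index (elements-complete y) , sym (lookup-index (elements-complete y))

  ×1≡0⇒multiple×1≡0 : ∀ {n} a → n ×′ 1# ≡ 0# → (a ℕ.* n) ×′ 1# ≡ 0#
  ×1≡0⇒multiple×1≡0 {n} a n≡0 = trans (×1-homo-* a n) (trans (cong (a ×′ 1# *_) n≡0) (zeroʳ _))

  power×1≡0⇒×1≡0 : ∀ p k → (p ^ k) ×′ 1# ≡ 0# → p ×′ 1# ≡ 0#
  power×1≡0⇒×1≡0 p zero    1+0≡0 = ⊥-elim (1≢0 (trans (sym (+-identityʳ 1#)) 1+0≡0))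
  power×1≡0⇒×1≡0 p (suc k) pᵏ⁺¹≡0 with (p ×′ 1#) ≟ 0#
  ... | yes p≡0 = p≡0
  ... | no  p≢0 = power×1≡0⇒×1≡0 p k (x*y≡0⇒y≡0 p≢0 (trans (sym (×1-homo-* p (p ^ k))) pᵏ⁺¹≡0))

  successor×1≢0 : ∀ {a b} → suc a ≡ b → a ×′ 1# ≡ 0# → b ×′ 1# ≢ 0#
  successor×1≢0 {a} refl a≡0 1+a≡0 = 1≢0 (begin
    1#             ≡⟨ +-identityʳ 1# ⟨
    1# + 0#        ≡⟨ cong (1# +_) a≡0 ⟨
    1# + a ×′ 1#   ≡⟨ 1+a≡0 ⟩
    0#             ∎)
    where open ≡-Reasoning

  coprime-to-characteristic : ∀ {p m} → p ×′ 1# ≡ 0# → Coprime p m → m ×′ 1# ≢ 0#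
  coprime-to-characteristic p≡0 coprime m≡0 with coprime-Bézout coprime
  ... | Bézout.+- a b 1+bm≡ap =
    successor×1≢0 1+bm≡ap (×1≡0⇒multiple×1≡0 b m≡0) (×1≡0⇒multiple×1≡0 a p≡0)
  ... | Bézout.-+ a b 1+ap≡bm =
    successor×1≢0 1+ap≡bm (×1≡0⇒multiple×1≡0 a p≡0) (×1≡0⇒multiple×1≡0 b m≡0)

  order-prime-power⇒×1≢0 : ∀ {p k n} → Prime p → order ≡ p ^ k → ¬ p ∣ n → n ×′ 1# ≢ 0#
  order-prime-power⇒×1≢0 {p} {k} p-prime order≡pᵏ p∤n = coprime-to-characteristic
    (power×1≡0⇒×1≡0 p k (subst (λ r → r ×′ 1# ≡ 0#) order≡pᵏ order×1≡0)) (prime∤⇒coprime p-prime p∤n)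

module AffineStabiliser (K : FiniteField) {ℓ} (U : Pred (FiniteField.Carrier K) ℓ) where
  open FieldTheory K
  open Characteristic K using (_×′_; ×-assoc-*; size×shift≡0)

  affine : Carrier → Carrier → Carrier → Carrier
  affine c l u = c + l * u

  affine⁻¹ : Carrier → Carrier → Carrier → Carrier
  affine⁻¹ c l = affine (- (c * l ⁻¹)) (l ⁻¹)

  Stabilises : Carrier → Carrier → Set ℓ
  Stabilises c l = l ≢ 0# × (∀ {u} → U u → U (affine c l u))

  Period : Carrier → Set ℓ
  Period n = ∀ {u} → U u → U (u + n)

  fixedPoint : Carrier → Carrier → Carrier
  fixedPoint c l = c * (1# - l) ⁻¹

  private
    variable
      c c₁ c₂ l l₁ l₂ n Q₁ Q₂ : Carrier

  affine-injective : l ≢ 0# → Injective _≡_ _≡_ (affine c l)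
  affine-injective {c = c} l≢0 = *-cancelˡ l≢0 ∘ +-cancelˡ c

  affine-∘ : ∀ c₁ l₁ c₂ l₂ u → affine c₁ l₁ (affine c₂ l₂ u) ≡ affine (c₁ + l₁ * c₂) (l₁ * l₂) u
  affine-∘ = solve 5 (λ c₁ l₁ c₂ l₂ u → c₁ :+ l₁ :* (c₂ :+ l₂ :* u) := (c₁ :+ l₁ :* c₂) :+ (l₁ :* l₂) :* u) refl

  affine-inverseʳ : l ≢ 0# → ∀ v → affine c l (affine⁻¹ c l v) ≡ v
  affine-inverseʳ {l} {c} l≢0 v = begin
    c + l * (- (c * l ⁻¹) + l ⁻¹ * v)
      ≡⟨ solve 4 (λ c l l⁻¹ v → c :+ l :* (:- (c :* l⁻¹) :+ l⁻¹ :* v) := c :+ (v :- c) :* (l :* l⁻¹)) refl c l (l ⁻¹) v ⟩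
    c + (v - c) * (l * l ⁻¹)   ≡⟨ cong (λ t → c + (v - c) * t) (x*x⁻¹≡1 l≢0) ⟩
    c + (v - c) * 1#           ≡⟨ solve 2 (λ c v → c :+ (v :- c) :* con 1ℤ := v) refl c v ⟩
    v                          ∎
    where open ≡-Reasoning

  affine-inverseˡ : l ≢ 0# → ∀ u → affine⁻¹ c l (affine c l u) ≡ u
  affine-inverseˡ {l} {c} l≢0 u =
    trans (solve 4 (λ c l l⁻¹ u → :- (c :* l⁻¹) :+ l⁻¹ :* (c :+ l :* u) := l :* (u :* l⁻¹)) refl c l (l ⁻¹) u)
          (x*[y*x⁻¹]≡y l≢0 u)

  stabilises-inverse : Stabilises c l → Stabilises (- (c * l ⁻¹)) (l ⁻¹)
  stabilises-inverse {c = c} (l≢0 , preserves) =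
    ⁻¹-≢0 l≢0 , inverse-preserves (affine-injective {c = c} l≢0) U preserves (affine-inverseʳ l≢0)

  stabilises-from-inverse : l ≢ 0# → (∀ {u} → U u → U (affine⁻¹ c l u)) → Stabilises c l
  stabilises-from-inverse {l = l} {c = c} l≢0 preserves =
    l≢0 , inverse-preserves (affine-injective {c = - (c * l ⁻¹)} (⁻¹-≢0 l≢0)) U preserves (affine-inverseˡ l≢0)

  stabilises-∘ : Stabilises c₁ l₁ → Stabilises c₂ l₂ → Stabilises (c₁ + l₁ * c₂) (l₁ * l₂)
  stabilises-∘ {c₁} {l₁} {c₂} {l₂} (l₁≢0 , preserves₁) (l₂≢0 , preserves₂) =
    *-≢0 l₁≢0 l₂≢0 , λ {u} Uu → subst U (affine-∘ c₁ l₁ c₂ l₂ u) (preserves₁ (preserves₂ Uu))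

  period-+ : ∀ {a b} → Period a → Period b → Period (a + b)
  period-+ {a} {b} period-a period-b {u} Uu = subst U (+-assoc u a b) (period-b (period-a Uu))

  period-neg : Period n → Period (- n)
  period-neg {n} period =
    inverse-preserves (+-cancelʳ n) U period (λ v → solve 2 (λ v n → v :+ :- n :+ n := v) refl v n)

  period-scale : Stabilises c l → Period n → Period (l * n)
  period-scale {c} {l} {n} σ@(l≢0 , preserves) period {u} Uu =
    subst U conjugate (preserves (period (proj₂ (stabilises-inverse σ) Uu)))
    where
    open ≡-Reasoning
    σ⁻¹u = affine⁻¹ c l u
    conjugate : affine c l (σ⁻¹u + n) ≡ u + l * n
    conjugate = begin
      c + l * (σ⁻¹u + n)        ≡⟨ solve 4 (λ c l s n → c :+ l :* (s :+ n) := (c :+ l :* s) :+ l :* n) refl c l σ⁻¹u n ⟩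
      affine c l σ⁻¹u + l * n   ≡⟨ cong (_+ l * n) (affine-inverseʳ l≢0 u) ⟩
      u + l * n                 ∎

  period-1-scale : Stabilises c l → Period n → Period ((1# - l) * n)
  period-1-scale {c} {l} {n} σ period =
    subst Period (solve 2 (λ l n → n :+ :- (l :* n) := (con 1ℤ :- l) :* n) refl l n)
      (period-+ period (period-neg (period-scale σ period)))

  period-cancel : ∀ {μ} → μ ≢ 0# → (∀ {n} → Period n → Period (μ * n)) → Period (μ * n) → Period n
  period-cancel {n} {μ} μ≢0 μ-preserves period
    with v , period-v , μv≡μn ← preimage (*-cancelˡ μ≢0) Period μ-preserves period =
    subst Period (*-cancelˡ μ≢0 μv≡μn) period-v

  commutator-period : Stabilises c₁ l₁ → Stabilises c₂ l₂ → Period (c₁ * (1# - l₂) - c₂ * (1# - l₁))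
  commutator-period {c₁} {l₁} {c₂} {l₂} σ₁@(l₁≢0 , preserves₁) σ₂@(l₂≢0 , preserves₂) {u} Uu =
    subst U commutator (preserves₁ (preserves₂ (proj₂ (stabilises-inverse σ₁) (proj₂ (stabilises-inverse σ₂) Uu))))
    where
    open ≡-Reasoning
    κ = c₁ * (1# - l₂) - c₂ * (1# - l₁)
    σ₂⁻¹u = affine⁻¹ c₂ l₂ u
    v = affine⁻¹ c₁ l₁ σ₂⁻¹u
    commutator : affine c₁ l₁ (affine c₂ l₂ v) ≡ u + κ
    commutator = begin
      affine c₁ l₁ (affine c₂ l₂ v)
        ≡⟨ solve 5 (λ c₁ l₁ c₂ l₂ v → c₁ :+ l₁ :* (c₂ :+ l₂ :* v)
                                    := (c₂ :+ l₂ :* (c₁ :+ l₁ :* v)) :+ (c₁ :* (con 1ℤ :- l₂) :- c₂ :* (con 1ℤ :- l₁)))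
                   refl c₁ l₁ c₂ l₂ v ⟩
      affine c₂ l₂ (affine c₁ l₁ v) + κ   ≡⟨ cong (λ t → affine c₂ l₂ t + κ) (affine-inverseʳ l₁≢0 σ₂⁻¹u) ⟩
      affine c₂ l₂ σ₂⁻¹u + κ              ≡⟨ cong (_+ κ) (affine-inverseʳ l₂≢0 u) ⟩
      u + κ                               ∎

  1-l≢0 : l ≢ 1# → 1# - l ≢ 0#
  1-l≢0 l≢1 = l≢1 ∘ sym ∘ x-y≡0⇒x≡y

  fixedPoint-fixed : l ≢ 1# → affine c l (fixedPoint c l) ≡ fixedPoint c l
  fixedPoint-fixed {l} {c} l≢1 = begin
    c + l * Q              ≡⟨ cong (_+ l * Q) (x*[y*x⁻¹]≡y (1-l≢0 l≢1) c) ⟨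
    (1# - l) * Q + l * Q   ≡⟨ solve 2 (λ l Q → (con 1ℤ :- l) :* Q :+ l :* Q := Q) refl l Q ⟩
    Q                      ∎
    where
    open ≡-Reasoning
    Q = fixedPoint c l

  fixed⇒offset : ∀ {Q} → affine c l Q ≡ Q → c ≡ (1# - l) * Q
  fixed⇒offset {c} {l} {Q} fixed = begin
    c                     ≡⟨ solve 3 (λ c l Q → c := (c :+ l :* Q) :- l :* Q) refl c l Q ⟩
    (c + l * Q) - l * Q   ≡⟨ cong (_- l * Q) fixed ⟩
    Q - l * Q             ≡⟨ solve 2 (λ l Q → Q :- l :* Q := (con 1ℤ :- l) :* Q) refl l Q ⟩
    (1# - l) * Q          ∎
    where open ≡-Reasoning

  fixed-points-differ-by-period : Stabilises c₁ l₁ → Stabilises c₂ l₂ → l₁ ≢ 1# → l₂ ≢ 1# →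
                                  affine c₁ l₁ Q₁ ≡ Q₁ → affine c₂ l₂ Q₂ ≡ Q₂ → Period (Q₁ - Q₂)
  fixed-points-differ-by-period {c₁} {l₁} {c₂} {l₂} {Q₁} {Q₂} σ₁ σ₂ l₁≢1 l₂≢1 fixed₁ fixed₂ =
    period-cancel (1-l≢0 l₂≢1) (period-1-scale σ₂)
      (period-cancel (1-l≢0 l₁≢1) (period-1-scale σ₁) (subst Period commutator≡ (commutator-period σ₁ σ₂)))
    where
    open ≡-Reasoning
    commutator≡ : c₁ * (1# - l₂) - c₂ * (1# - l₁) ≡ (1# - l₁) * ((1# - l₂) * (Q₁ - Q₂))
    commutator≡ = begin
      c₁ * (1# - l₂) - c₂ * (1# - l₁)
        ≡⟨ cong₂ (λ a b → a * (1# - l₂) - b * (1# - l₁)) (fixed⇒offset fixed₁) (fixed⇒offset fixed₂) ⟩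
      (1# - l₁) * Q₁ * (1# - l₂) - (1# - l₂) * Q₂ * (1# - l₁)
        ≡⟨ solve 4 (λ l₁ l₂ Q₁ Q₂ → (con 1ℤ :- l₁) :* Q₁ :* (con 1ℤ :- l₂) :- (con 1ℤ :- l₂) :* Q₂ :* (con 1ℤ :- l₁)
                                 := (con 1ℤ :- l₁) :* ((con 1ℤ :- l₂) :* (Q₁ :- Q₂)))
                   refl l₁ l₂ Q₁ Q₂ ⟩
      (1# - l₁) * ((1# - l₂) * (Q₁ - Q₂))
        ∎

  fixed-point∈U : Stabilises c₁ l₁ → Stabilises c₂ l₂ → l₁ ≢ 1# → l₂ ≢ 1# →
                  affine c₁ l₁ Q₁ ≡ Q₁ → U (fixedPoint c₂ l₂) → U Q₁
  fixed-point∈U {c₁} {l₁} {c₂} {l₂} {Q₁} σ₁ σ₂ l₁≢1 l₂≢1 fixed₁ UQ₂ =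
    subst U (solve 2 (λ Q₂ Q₁ → Q₂ :+ (Q₁ :- Q₂) := Q₁) refl (fixedPoint c₂ l₂) Q₁)
      (fixed-points-differ-by-period σ₁ σ₂ l₁≢1 l₂≢1 fixed₁ (fixedPoint-fixed l₂≢1) UQ₂)

  agreementPoint : Carrier → Carrier → Carrier → Carrier → Carrier
  agreementPoint A B A′ B′ = (A - A′) * (B′ - B) ⁻¹

  agreementPoint-agrees : ∀ {A B A′ B′} → B ≢ B′ →
    let R = agreementPoint A B A′ B′ in affine A′ B′ R ≡ affine A B R
  agreementPoint-agrees {A} {B} {A′} {B′} B≢B′ = begin
    A′ + B′ * R
      ≡⟨ solve 5 (λ A A′ B B′ R → A′ :+ B′ :* R := A :+ B :* R :+ (A′ :- A :+ (B′ :- B) :* R)) refl A A′ B B′ R ⟩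
    A + B * R + (A′ - A + (B′ - B) * R)
      ≡⟨ cong (λ t → A + B * R + (A′ - A + t)) (x*[y*x⁻¹]≡y (B≢B′ ∘ sym ∘ x-y≡0⇒x≡y) (A - A′)) ⟩
    A + B * R + (A′ - A + (A - A′))
      ≡⟨ solve 4 (λ A A′ B R → A :+ B :* R :+ (A′ :- A :+ (A :- A′)) := A :+ B :* R) refl A A′ B R ⟩
    A + B * R
      ∎
    where
    open ≡-Reasoning
    R = agreementPoint A B A′ B′

  non-translation-anchor : l ≢ 1# → l ≡ 1# ⊎ U (fixedPoint c l) → U (fixedPoint c l)
  non-translation-anchor l≢1 = [ ⊥-elim ∘ l≢1 , id ]′

  agreementPoint∈U : ∀ {A B A′ B′} → Stabilises A B → Stabilises A′ B′ →
                     (B ≡ 1# ⊎ U (fixedPoint A B)) → (B′ ≡ 1# ⊎ U (fixedPoint A′ B′)) → B ≢ B′ →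
                     U (agreementPoint A B A′ B′)
  agreementPoint∈U {A} {B} {A′} {B′} σ@(B≢0 , _) σ′ anchored anchored′ B≢B′ = by-cases (B ≟ 1#)
    where
    open ≡-Reasoning
    R = agreementPoint A B A′ B′
    τ : Stabilises (- (A * B ⁻¹) + B ⁻¹ * A′) (B ⁻¹ * B′)
    τ = stabilises-∘ (stabilises-inverse σ) σ′
    τ-fixes-R : affine (- (A * B ⁻¹) + B ⁻¹ * A′) (B ⁻¹ * B′) R ≡ R
    τ-fixes-R = begin
      affine (- (A * B ⁻¹) + B ⁻¹ * A′) (B ⁻¹ * B′) R   ≡⟨ affine-∘ (- (A * B ⁻¹)) (B ⁻¹) A′ B′ R ⟨
      affine⁻¹ A B (affine A′ B′ R)                      ≡⟨ cong (affine⁻¹ A B) (agreementPoint-agrees B≢B′) ⟩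
      affine⁻¹ A B (affine A B R)                        ≡⟨ affine-inverseˡ B≢0 R ⟩
      R                                                  ∎
    τ-linear≢1 : B ⁻¹ * B′ ≢ 1#
    τ-linear≢1 B⁻¹B′≡1 = B≢B′ (sym (begin
      B′                ≡⟨ x*[y*x⁻¹]≡y B≢0 B′ ⟨
      B * (B′ * B ⁻¹)   ≡⟨ cong (B *_) (trans (*-comm B′ (B ⁻¹)) B⁻¹B′≡1) ⟩
      B * 1#            ≡⟨ *-identityʳ B ⟩
      B                 ∎))
    by-cases : Dec (B ≡ 1#) → U R
    by-cases (no B≢1)  = fixed-point∈U τ σ τ-linear≢1 B≢1 τ-fixes-R (non-translation-anchor B≢1 anchored)
    by-cases (yes B≡1) = fixed-point∈U τ σ′ τ-linear≢1 B′≢1 τ-fixes-R (non-translation-anchor B′≢1 anchored′)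
      where
      B′≢1 : B′ ≢ 1#
      B′≢1 B′≡1 = B≢B′ (trans B≡1 (sym B′≡1))

  module Enumerated {s} {v : Fin s → Carrier} (v-injective : Injective _≡_ _≡_ v)
                    (v-enumerates : ∀ {u} → U u → ∃ λ k → v k ≡ u) (v∈U : ∀ k → U (v k))
                    (s≢0 : s ×′ 1# ≢ 0#) where

    period≡0 : Period n → n ≡ 0#
    period≡0 {n} period = x*y≡0⇒y≡0 s≢0 (begin
      s ×′ 1# * n     ≡⟨ ×-assoc-* s 1# n ⟩
      s ×′ (1# * n)   ≡⟨ cong (s ×′_) (*-identityˡ n) ⟩
      s ×′ n          ≡⟨ size×shift≡0 v-injective (shift period) (shift (period-neg period)) ⟩
      0#              ∎)
      where
      open ≡-Reasoning
      shift : ∀ {n} → Period n → ∀ k → ∃ λ l → v l ≡ v k + n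
      shift period k = v-enumerates (period (v∈U k))

    translation-stabiliser-trivial : Stabilises c 1# → c ≡ 0#
    translation-stabiliser-trivial {c} (_ , preserves) = period≡0 (λ {u} Uu →
      subst U (trans (cong (c +_) (*-identityˡ u)) (+-comm c u)) (preserves Uu))

    fixedPoints-equal : Stabilises c₁ l₁ → Stabilises c₂ l₂ → l₁ ≢ 1# → l₂ ≢ 1# →
                        fixedPoint c₁ l₁ ≡ fixedPoint c₂ l₂
    fixedPoints-equal σ₁ σ₂ l₁≢1 l₂≢1 = x-y≡0⇒x≡y (period≡0
      (fixed-points-differ-by-period σ₁ σ₂ l₁≢1 l₂≢1 (fixedPoint-fixed l₁≢1) (fixedPoint-fixed l₂≢1)))

module Plane (K : FiniteField) where
  open FieldTheory K
  open Net K using (Point; _⊕_; _⊖_; _·_; 𝟎)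

  ⊕-⊖-cancel : ∀ u v → u ⊕ (v ⊖ u) ≡ v
  ⊕-⊖-cancel (u₁ , u₂) (v₁ , v₂) = cong₂ _,_ (cancel u₁ v₁) (cancel u₂ v₂)
    where
    cancel : ∀ u v → u + (v - u) ≡ v
    cancel = solve 2 (λ u v → u :+ (v :- u) := v) refl

  ·-assoc : ∀ s t v → s · (t · v) ≡ (s * t) · v
  ·-assoc s t (v₁ , v₂) = cong₂ _,_ (sym (*-assoc s t v₁)) (sym (*-assoc s t v₂))

  ⁻¹·-cancel : ∀ {t} → t ≢ 0# → ∀ v → t ⁻¹ · (t · v) ≡ v
  ⁻¹·-cancel t≢0 (v₁ , v₂) = cong₂ _,_ (x⁻¹*[x*y]≡y t≢0 v₁) (x⁻¹*[x*y]≡y t≢0 v₂)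

  ⊖-anticomm : ∀ u v → v ⊖ u ≡ (- 1#) · (u ⊖ v)
  ⊖-anticomm (u₁ , u₂) (v₁ , v₂) = cong₂ _,_ (anticomm u₁ v₁) (anticomm u₂ v₂)
    where
    anticomm : ∀ u v → v - u ≡ - 1# * (u - v)
    anticomm = solve 2 (λ u v → v :- u := :- con 1ℤ :* (u :- v)) refl

  ⊖≡0·⇒≡ : ∀ {p q} v → q ⊖ p ≡ 0# · v → q ≡ p
  ⊖≡0·⇒≡ {p} {q} v eq = begin
    q              ≡⟨ ⊕-⊖-cancel p q ⟨
    p ⊕ (q ⊖ p)    ≡⟨ cong (p ⊕_) eq ⟩
    p ⊕ (0# · v)   ≡⟨ cong₂ _,_ (vanish (proj₁ p) (proj₁ v)) (vanish (proj₂ p) (proj₂ v)) ⟩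
    p              ∎
    where
    open ≡-Reasoning
    vanish : ∀ p v → p + 0# * v ≡ p
    vanish = solve 2 (λ p v → p :+ con 0ℤ :* v := p) refl

  det : Point → Point → Carrier
  det (u₁ , u₂) (v₁ , v₂) = u₁ * v₂ - u₂ * v₁

  det-swap : ∀ u v → det (swap u) (swap v) ≡ - det u v
  det-swap (u₁ , u₂) (v₁ , v₂) =
    solve 4 (λ u₁ u₂ v₁ v₂ → u₂ :* v₁ :- u₁ :* v₂ := :- (u₁ :* v₂ :- u₂ :* v₁)) refl u₁ u₂ v₁ v₂

  private
    proportional-to-first≢0 : ∀ {u v} → proj₁ u ≢ 0# → det u v ≡ 0# → ∃ λ t → v ≡ t · u
    proportional-to-first≢0 {u₁ , u₂} {v₁ , v₂} u₁≢0 det≡0 = v₁ * u₁ ⁻¹ , cong₂ _,_ first second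
      where
      open ≡-Reasoning
      first : v₁ ≡ v₁ * u₁ ⁻¹ * u₁
      first = sym (trans (*-comm _ u₁) (x*[y*x⁻¹]≡y u₁≢0 v₁))
      second : v₂ ≡ v₁ * u₁ ⁻¹ * u₂
      second = sym (begin
        v₁ * u₁ ⁻¹ * u₂     ≡⟨ solve 3 (λ v₁ u₁⁻¹ u₂ → v₁ :* u₁⁻¹ :* u₂ := u₁⁻¹ :* (u₂ :* v₁)) refl v₁ (u₁ ⁻¹) u₂ ⟩
        u₁ ⁻¹ * (u₂ * v₁)   ≡⟨ cong (u₁ ⁻¹ *_) (x-y≡0⇒x≡y det≡0) ⟨
        u₁ ⁻¹ * (u₁ * v₂)   ≡⟨ x⁻¹*[x*y]≡y u₁≢0 v₂ ⟩
        v₂                  ∎)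

  det≡0⇒proportional : ∀ {u v} → u ≢ 𝟎 → det u v ≡ 0# → ∃ λ t → v ≡ t · u
  det≡0⇒proportional {u₁ , u₂} {v} u≢0 det≡0 with u₁ ≟ 0#
  ... | no u₁≢0  = proportional-to-first≢0 u₁≢0 det≡0
  ... | yes refl = map₂ (cong swap) (proportional-to-first≢0 (u≢0 ∘ cong (0# ,_))
                     (trans (det-swap (0# , u₂) v) (trans (cong -_ det≡0) -0#≡0#)))

  module Basis (d w : Point) (det≢0 : det d w ≢ 0#) where

    vec : Carrier → Carrier → Point
    vec p q = (p · d) ⊕ (q · w)

    α β : Point → Carrier
    α v = det v w * det d w ⁻¹
    β v = det d v * det d w ⁻¹

    private
      Δ⁻¹ = det d w ⁻¹
      d₁ = proj₁ d
      d₂ = proj₂ d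
      w₁ = proj₁ w
      w₂ = proj₂ w

    α-vec : ∀ p q → α (vec p q) ≡ p
    α-vec p q = trans
      (solve 7 (λ p q d₁ d₂ w₁ w₂ Δ⁻¹ → ((p :* d₁ :+ q :* w₁) :* w₂ :- (p :* d₂ :+ q :* w₂) :* w₁) :* Δ⁻¹
                                      := (d₁ :* w₂ :- d₂ :* w₁) :* (p :* Δ⁻¹)) refl p q d₁ d₂ w₁ w₂ Δ⁻¹)
      (x*[y*x⁻¹]≡y det≢0 p)

    β-vec : ∀ p q → β (vec p q) ≡ q
    β-vec p q = trans
      (solve 7 (λ p q d₁ d₂ w₁ w₂ Δ⁻¹ → (d₁ :* (p :* d₂ :+ q :* w₂) :- d₂ :* (p :* d₁ :+ q :* w₁)) :* Δ⁻¹
                                      := (d₁ :* w₂ :- d₂ :* w₁) :* (q :* Δ⁻¹)) refl p q d₁ d₂ w₁ w₂ Δ⁻¹)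
      (x*[y*x⁻¹]≡y det≢0 q)

    vec-αβ : ∀ v → vec (α v) (β v) ≡ v
    vec-αβ (v₁ , v₂) = cong₂ _,_
      (trans (solve 7 (λ v₁ v₂ d₁ d₂ w₁ w₂ Δ⁻¹ → (v₁ :* w₂ :- v₂ :* w₁) :* Δ⁻¹ :* d₁ :+ (d₁ :* v₂ :- d₂ :* v₁) :* Δ⁻¹ :* w₁
                                              := (d₁ :* w₂ :- d₂ :* w₁) :* (v₁ :* Δ⁻¹)) refl v₁ v₂ d₁ d₂ w₁ w₂ Δ⁻¹)
             (x*[y*x⁻¹]≡y det≢0 v₁))
      (trans (solve 7 (λ v₁ v₂ d₁ d₂ w₁ w₂ Δ⁻¹ → (v₁ :* w₂ :- v₂ :* w₁) :* Δ⁻¹ :* d₂ :+ (d₁ :* v₂ :- d₂ :* v₁) :* Δ⁻¹ :* w₂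
                                              := (d₁ :* w₂ :- d₂ :* w₁) :* (v₂ :* Δ⁻¹)) refl v₁ v₂ d₁ d₂ w₁ w₂ Δ⁻¹)
             (x*[y*x⁻¹]≡y det≢0 v₂))

    vec-injective : ∀ {p q p′ q′} → vec p q ≡ vec p′ q′ → p ≡ p′ × q ≡ q′
    vec-injective {p} {q} {p′} {q′} eq =
      trans (sym (α-vec p q)) (trans (cong α eq) (α-vec p′ q′)) ,
      trans (sym (β-vec p q)) (trans (cong β eq) (β-vec p′ q′))

    ·-vec : ∀ t p q → t · vec p q ≡ vec (t * p) (t * q)
    ·-vec t p q = cong₂ _,_ (distribute d₁ w₁) (distribute d₂ w₂)
      where
      distribute : ∀ d w → t * (p * d + q * w) ≡ t * p * d + t * q * w
      distribute = solve 5 (λ t p q d w → t :* (p :* d :+ q :* w) := t :* p :* d :+ t :* q :* w) refl t p q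

    vec-d : ∀ p → vec p 0# ≡ p · d
    vec-d p = cong₂ _,_ (drop d₁ w₁) (drop d₂ w₂)
      where
      drop : ∀ d w → p * d + 0# * w ≡ p * d
      drop = solve 3 (λ p d w → p :* d :+ con 0ℤ :* w := p :* d) refl p

    vec-diff : ∀ a p q p′ q′ → (a ⊕ vec p′ q′) ⊖ (a ⊕ vec p q) ≡ vec (p′ - p) (q′ - q)
    vec-diff (a₁ , a₂) p q p′ q′ = cong₂ _,_ (difference a₁ d₁ w₁) (difference a₂ d₂ w₂)
      where
      difference : ∀ a d w → (a + (p′ * d + q′ * w)) - (a + (p * d + q * w)) ≡ (p′ - p) * d + (q′ - q) * w
      difference = solve 7 (λ p q p′ q′ a d w → (a :+ (p′ :* d :+ q′ :* w)) :- (a :+ (p :* d :+ q :* w))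
                                               := (p′ :- p) :* d :+ (q′ :- q) :* w) refl p q p′ q′

module NetGeometry (K : FiniteField) {m : ℕ} (D : Net.Directions K m) where
  open FieldTheory K
  open Plane K
  open Net K
  open Directions D

  IsDirection : Pred Point 0ℓ
  IsDirection v = Σ (Fin m) λ j → Σ Carrier λ t → v ≡ t · dir j

  isDirection-scale : ∀ s {v} → IsDirection v → IsDirection (s · v)
  isDirection-scale s (j , t , v≡t·dⱼ) = j , s * t , trans (cong (s ·_) v≡t·dⱼ) (·-assoc s t (dir j))

  Adj-sym : ∀ {u v} → Adj D u v → Adj D v u
  Adj-sym {u} {v} (u≢v , v-u) =
    u≢v ∘ sym , subst IsDirection (sym (⊖-anticomm v u)) (isDirection-scale (- 1#) v-u)

  line-diff : ∀ b e s s′ → (b ⊕ (s′ · e)) ⊖ (b ⊕ (s · e)) ≡ (s′ - s) · e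
  line-diff (b₁ , b₂) (e₁ , e₂) s s′ = cong₂ _,_ (difference b₁ e₁) (difference b₂ e₂)
    where
    difference : ∀ b e → (b + s′ * e) - (b + s * e) ≡ (s′ - s) * e
    difference = solve 4 (λ s s′ b e → (b :+ s′ :* e) :- (b :+ s :* e) := (s′ :- s) :* e) refl s s′

  onLine-adjacent : ∀ ℓ {y y′} → OnLine D ℓ y → OnLine D ℓ y′ → y ≢ y′ → Adj D y y′
  onLine-adjacent (line b j) (s , refl) (s′ , refl) y≢y′ = y≢y′ , j , s′ - s , line-diff b (dir j) s s′

  ⊖-onLine : ∀ {x y j t} → y ⊖ x ≡ t · dir j → OnLine D (line x j) y
  ⊖-onLine {x} {y} {j} {t} eq = t , trans (sym (⊕-⊖-cancel x y)) (cong (x ⊕_) eq)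

  onLine-base : ∀ x j → OnLine D (line x j) x
  onLine-base x j = 0# , cong₂ _,_ (vanish (proj₁ x) (proj₁ (dir j))) (vanish (proj₂ x) (proj₂ (dir j)))
    where
    vanish : ∀ x e → x ≡ x + 0# * e
    vanish = solve 2 (λ x e → x := x :+ con 0ℤ :* e) refl

  onLine-rebase : ∀ {b p j} → OnLine D (line b j) p → OnLine D (line b j) ⊆ OnLine D (line p j)
  onLine-rebase {b} {j = j} (s , refl) {z} (t , refl) =
    t - s , cong₂ _,_ (shift (proj₁ b) (proj₁ (dir j))) (shift (proj₂ b) (proj₂ (dir j)))
    where
    shift : ∀ b e → b + t * e ≡ (b + s * e) + (t - s) * e
    shift = solve 4 (λ s t b e → b :+ t :* e := (b :+ s :* e) :+ (t :- s) :* e) refl s t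

  onLine-unbase : ∀ {b p j} → OnLine D (line b j) p → OnLine D (line p j) ⊆ OnLine D (line b j)
  onLine-unbase {b} {j = j} (s , refl) {z} (t , refl) =
    s + t , cong₂ _,_ (shift (proj₁ b) (proj₁ (dir j))) (shift (proj₂ b) (proj₂ (dir j)))
    where
    shift : ∀ b e → (b + s * e) + t * e ≡ b + (s + t) * e
    shift = solve 4 (λ s t b e → (b :+ s :* e) :+ t :* e := b :+ (s :+ t) :* e) refl s t

  two-points-direction : ∀ {b₁ b₂ j₁ j₂ p q} → p ≢ q → OnLine D (line b₁ j₁) p → OnLine D (line b₁ j₁) q →
                         OnLine D (line b₂ j₂) p → OnLine D (line b₂ j₂) q → j₁ ≡ j₂
  two-points-direction {b₁} {b₂} {j₁} {j₂} p≢q (s₁ , refl) (s₁′ , refl) (s₂ , p≡) (s₂′ , q≡)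
    with j₁ Fin.≟ j₂
  ... | yes j₁≡j₂ = j₁≡j₂
  ... | no j₁≢j₂ = ⊥-elim (dir-distinct j₁ j₂ j₁≢j₂ (σ₂ ⁻¹ * σ₁ , (begin
    dir j₂                  ≡⟨ ⁻¹·-cancel σ₂≢0 (dir j₂) ⟨
    σ₂ ⁻¹ · (σ₂ · dir j₂)   ≡⟨ cong (σ₂ ⁻¹ ·_) (trans (sym q-p₂) q-p₁) ⟩
    σ₂ ⁻¹ · (σ₁ · dir j₁)   ≡⟨ ·-assoc (σ₂ ⁻¹) σ₁ (dir j₁) ⟩
    (σ₂ ⁻¹ * σ₁) · dir j₁   ∎)))
    where
    open ≡-Reasoning
    σ₁ = s₁′ - s₁
    σ₂ = s₂′ - s₂
    q-p₁ = line-diff b₁ (dir j₁) s₁ s₁′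
    q-p₂ : (b₁ ⊕ (s₁′ · dir j₁)) ⊖ (b₁ ⊕ (s₁ · dir j₁)) ≡ σ₂ · dir j₂
    q-p₂ = trans (cong₂ _⊖_ q≡ p≡) (line-diff b₂ (dir j₂) s₂ s₂′)
    σ₂≢0 : σ₂ ≢ 0#
    σ₂≢0 σ₂≡0 = p≢q (sym (⊖≡0·⇒≡ (dir j₂) (trans q-p₂ (cong (_· dir j₂) σ₂≡0))))

  line-determined : ∀ {ℓ₁ ℓ₂ p q} → p ≢ q → OnLine D ℓ₁ p → OnLine D ℓ₁ q →
                    OnLine D ℓ₂ p → OnLine D ℓ₂ q → OnLine D ℓ₁ ⊆ OnLine D ℓ₂
  line-determined {line b₁ j₁} {line b₂ j₂} p≢q p∈ℓ₁ q∈ℓ₁ p∈ℓ₂ q∈ℓ₂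
    with refl ← two-points-direction p≢q p∈ℓ₁ q∈ℓ₁ p∈ℓ₂ q∈ℓ₂ = onLine-unbase p∈ℓ₂ ∘ onLine-rebase p∈ℓ₁

  infix 4 _≟ₚ_
  _≟ₚ_ : DecidableEquality Point
  _≟ₚ_ = ≡-dec _≟_ _≟_

  module Points = Enumeration (cartesianProduct elements elements)
    (λ (u₁ , u₂) → ∈-cartesianProduct⁺ (elements-complete u₁) (elements-complete u₂))

  isDirection? : Decidable IsDirection
  isDirection? v = Fin.any? (λ j → search (λ t → v ≟ₚ t · dir j))

  Adj? : ∀ u v → Dec (Adj D u v)
  Adj? u v = ¬? (u ≟ₚ v) ×-dec isDirection? (v ⊖ u)

  onLine? : ∀ ℓ → Decidable (OnLine D ℓ)
  onLine? (line b j) z = search (λ t → z ≟ₚ b ⊕ (t · dir j))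

  CommonNeighbourhood : Pred Point 0ℓ → Pred Point 0ℓ
  CommonNeighbourhood S z = ∀ y → S y → y ≢ z → Adj D z y

  commonNeighbourhood? : ∀ {S} → Decidable S → Decidable (CommonNeighbourhood S)
  commonNeighbourhood? S? z = Points.universal λ y → S? y →-dec (¬? (y ≟ₚ z) →-dec Adj? z y)

  module _ {S : Pred Point 0ℓ} (S-clique : IsClique D S) where

    clique⇒⊆CommonNeighbourhood : ∀ {E} → IsClique D E → S ⊆ E → E ⊆ CommonNeighbourhood S
    clique⇒⊆CommonNeighbourhood E-clique S⊆E {z} Ez y Sy y≢z = E-clique z y Ez (S⊆E Sy) (y≢z ∘ sym)

    ⊆CommonNeighbourhood : S ⊆ CommonNeighbourhood S
    ⊆CommonNeighbourhood = clique⇒⊆CommonNeighbourhood S-clique id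

    CommonNeighbourhood⊆⇒maximal : CommonNeighbourhood S ⊆ S → IsMaximalClique D S
    CommonNeighbourhood⊆⇒maximal N⊆S =
      S-clique , λ E E-clique S⊆E → N⊆S ∘ clique⇒⊆CommonNeighbourhood E-clique S⊆E

    outside-neighbour : Decidable S → ¬ IsMaximalClique D S → ∃ λ z → CommonNeighbourhood S z × ¬ S z
    outside-neighbour S? ¬maximal with Points.search (λ z → commonNeighbourhood? S? z ×-dec ¬? (S? z))
    ... | yes found    = found
    ... | no  ¬found   = ⊥-elim (¬maximal (CommonNeighbourhood⊆⇒maximal N⊆S))
      where
      N⊆S : CommonNeighbourhood S ⊆ S
      N⊆S {z} Nz with S? z
      ... | yes Sz = Sz
      ... | no ¬Sz = ⊥-elim (¬found (z , Nz , ¬Sz))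

    module _ (N-clique : IsClique D (CommonNeighbourhood S)) where

      CommonNeighbourhood-maximal : IsMaximalClique D (CommonNeighbourhood S)
      CommonNeighbourhood-maximal = N-clique , λ E E-clique N⊆E →
        clique⇒⊆CommonNeighbourhood E-clique (N⊆E ∘ ⊆CommonNeighbourhood)

      CommonNeighbourhood-unique : ∀ C → IsMaximalClique D C → S ⊆ C → _≐_ D C (CommonNeighbourhood S)
      CommonNeighbourhood-unique C (C-clique , C-maximal) S⊆C =
        C⊆N , C-maximal (CommonNeighbourhood S) N-clique C⊆N
        where
        C⊆N = clique⇒⊆CommonNeighbourhood C-clique S⊆C


module Frame (K : FiniteField) {m′ : ℕ} (D : Net.Directions K (suc m′)) (a : Net.Point K) (i : Fin (suc m′))
             (x : Net.Point K) (x∉L : ¬ Net.OnLine K D (Net.line a i) x) where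
  open FieldTheory K
  open Characteristic K using (_×′_)
  open Plane K
  open Net K
  open Directions D
  open NetGeometry K D

  L : Line D
  L = line a i

  d w : Point
  d = dir i
  w = x ⊖ a

  det≢0 : det d w ≢ 0#
  det≢0 det≡0 with t , w≡t·d ← det≡0⇒proportional (dir-nonzero i) det≡0 =
    x∉L (t , trans (sym (⊕-⊖-cancel a x)) (cong (a ⊕_) w≡t·d))

  open Basis d w det≢0

  point : Carrier → Carrier → Point
  point A B = a ⊕ vec A B

  Ac Bc : Point → Carrier
  Ac z = α (z ⊖ a)
  Bc z = β (z ⊖ a)

  point-coords : ∀ z → point (Ac z) (Bc z) ≡ z
  point-coords z = trans (cong (a ⊕_) (vec-αβ (z ⊖ a))) (⊕-⊖-cancel a z)

  ⊖-coords : ∀ u v → v ⊖ u ≡ vec (Ac v - Ac u) (Bc v - Bc u)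
  ⊖-coords u v =
    trans (sym (cong₂ _⊖_ (point-coords v) (point-coords u))) (vec-diff a (Ac u) (Bc u) (Ac v) (Bc v))

  x≡point01 : x ≡ point 0# 1#
  x≡point01 =
    trans (sym (⊕-⊖-cancel a x)) (cong (a ⊕_) (cong₂ _,_ (pick (proj₁ d) (proj₁ w)) (pick (proj₂ d) (proj₂ w))))
    where
    pick : ∀ d w → w ≡ 0# * d + 1# * w
    pick = solve 2 (λ d w → w := con 0ℤ :* d :+ con 1ℤ :* w) refl

  L-point : ∀ s → a ⊕ (s · d) ≡ point s 0#
  L-point s = cong (a ⊕_) (sym (vec-d s))

  Bc≡0⇒onL : ∀ {z} → Bc z ≡ 0# → OnLine D L z
  Bc≡0⇒onL {z} B≡0 = Ac z , (begin
    z                     ≡⟨ point-coords z ⟨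
    point (Ac z) (Bc z)   ≡⟨ cong (point (Ac z)) B≡0 ⟩
    point (Ac z) 0#       ≡⟨ L-point (Ac z) ⟨
    a ⊕ (Ac z · d)        ∎)
    where open ≡-Reasoning

  Slope : Pred Carrier 0ℓ
  Slope s = IsDirection (vec s (- 1#))

  ·-slope : ∀ c s → c · vec s (- 1#) ≡ vec (c * s) (- c)
  ·-slope c s = trans (·-vec c s (- 1#)) (cong (vec (c * s)) (solve 1 (λ c → c :* :- con 1ℤ := :- c) refl c))

  slope⇒direction : ∀ c {s} → Slope s → IsDirection (vec (c * s) (- c))
  slope⇒direction c {s} (j , t , e) = j , c * t , (begin
    vec (c * s) (- c)   ≡⟨ ·-slope c s ⟨
    c · vec s (- 1#)    ≡⟨ cong (c ·_) e ⟩
    c · (t · dir j)     ≡⟨ ·-assoc c t (dir j) ⟩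
    (c * t) · dir j     ∎)
    where open ≡-Reasoning

  direction⇒slope : ∀ {c s} → c ≢ 0# → IsDirection (vec (c * s) (- c)) → Slope s
  direction⇒slope {c} {s} c≢0 direction = subst IsDirection (begin
    c ⁻¹ · vec (c * s) (- c)    ≡⟨ cong (c ⁻¹ ·_) (·-slope c s) ⟨
    c ⁻¹ · (c · vec s (- 1#))   ≡⟨ ⁻¹·-cancel c≢0 (vec s (- 1#)) ⟩
    vec s (- 1#)                ∎) (isDirection-scale (c ⁻¹) direction)
    where open ≡-Reasoning

  Star : Pred Point 0ℓ
  Star = StarOn D x L

  Star? : Decidable Star
  Star? z = (z ≟ₚ x) ⊎-dec (Adj? x z ×-dec onLine? L z)

  Star-clique : IsClique D Star
  Star-clique u v (inj₁ refl)      (inj₁ refl)      u≢v = ⊥-elim (u≢v refl)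
  Star-clique u v (inj₁ refl)      (inj₂ (x~v , _)) u≢v = x~v
  Star-clique u v (inj₂ (x~u , _)) (inj₁ refl)      u≢v = Adj-sym x~u
  Star-clique u v (inj₂ (_ , u∈L)) (inj₂ (_ , v∈L)) u≢v = onLine-adjacent L u∈L v∈L u≢v

  x≢onL : ∀ {z} → OnLine D L z → x ≢ z
  x≢onL z∈L refl = x∉L z∈L

  slope⇒Star : ∀ {s} → Slope s → Star (a ⊕ (s · d))
  slope⇒Star {s} slope = inj₂ ((x≢onL (s , refl) , subst IsDirection (sym diff) slope) , (s , refl))
    where
    diff : (a ⊕ (s · d)) ⊖ x ≡ vec s (- 1#)
    diff = trans (cong₂ _⊖_ (L-point s) x≡point01) (trans (vec-diff a 0# 1# s 0#)
      (cong₂ vec (solve 1 (λ s → s :- con 0ℤ := s) refl s) (solve 0 (con 0ℤ :- con 1ℤ := :- con 1ℤ) refl)))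

  C : Pred Point 0ℓ
  C = CommonNeighbourhood Star

  C-onL⇒Star : ∀ {z} → C z → OnLine D L z → Star z
  C-onL⇒Star Cz z∈L = inj₂ (Adj-sym (Cz x (inj₁ refl) (x≢onL z∈L)) , z∈L)

  C∖Star : ∀ {z} → C z → ¬ Star z → ¬ OnLine D L z × z ≢ x
  C∖Star Cz ¬Star-z = ¬Star-z ∘ C-onL⇒Star Cz , ¬Star-z ∘ inj₁

  open AffineStabiliser K Slope

  -- For z off L, z is adjacent to the point (σ s , 0) of L, where σ = affine (Ac z) (Bc z), exactly
  -- when s is a slope; and if Bc z ≢ 1 then fixedPoint (Ac z) (Bc z) is the slope of the line xz.
  Good : Pred Point 0ℓ
  Good z = Stabilises (Ac z) (Bc z) × (Bc z ≡ 1# ⊎ Slope (fixedPoint (Ac z) (Bc z)))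

  ⊖x-fixedPoint : ∀ z → Bc z ≢ 1# → z ⊖ x ≡ vec ((1# - Bc z) * fixedPoint (Ac z) (Bc z)) (- (1# - Bc z))
  ⊖x-fixedPoint z B≢1 = begin
    z ⊖ x                                          ≡⟨ cong₂ _⊖_ (sym (point-coords z)) x≡point01 ⟩
    point A B ⊖ point 0# 1#                        ≡⟨ vec-diff a 0# 1# A B ⟩
    vec (A - 0#) (B - 1#)                          ≡⟨ cong₂ vec first second ⟩
    vec ((1# - B) * fixedPoint A B) (- (1# - B))   ∎
    where
    open ≡-Reasoning
    A = Ac z
    B = Bc z
    first : A - 0# ≡ (1# - B) * (A * (1# - B) ⁻¹)
    first = trans (solve 1 (λ A → A :- con 0ℤ := A) refl A) (sym (x*[y*x⁻¹]≡y (1-l≢0 B≢1) A))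
    second : B - 1# ≡ - (1# - B)
    second = solve 1 (λ B → B :- con 1ℤ := :- (con 1ℤ :- B)) refl B

  good : ∀ {z} → C z → ¬ OnLine D L z → z ≢ x → Good z
  good {z} Cz z∉L z≢x = stabilises-from-inverse B≢0 preserves , anchored
    where
    open ≡-Reasoning
    A = Ac z
    B = Bc z
    B≢0 : B ≢ 0#
    B≢0 = z∉L ∘ Bc≡0⇒onL
    preserves : ∀ {s} → Slope s → Slope (affine⁻¹ A B s)
    preserves {s} slope = direction⇒slope B≢0 (subst IsDirection diff (proj₂ (Cz _ (slope⇒Star slope) y≢z)))
      where
      y≢z : a ⊕ (s · d) ≢ z
      y≢z refl = z∉L (s , refl)
      diff : (a ⊕ (s · d)) ⊖ z ≡ vec (B * affine⁻¹ A B s) (- B)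
      diff = begin
        (a ⊕ (s · d)) ⊖ z                  ≡⟨ cong₂ _⊖_ (L-point s) (sym (point-coords z)) ⟩
        point s 0# ⊖ point A B             ≡⟨ vec-diff a A B s 0# ⟩
        vec (s - A) (0# - B)               ≡⟨ cong₂ vec first (solve 1 (λ B → con 0ℤ :- B := :- B) refl B) ⟩
        vec (B * affine⁻¹ A B s) (- B)     ∎
        where
        first : s - A ≡ B * (- (A * B ⁻¹) + B ⁻¹ * s)
        first = trans (sym (x*[y*x⁻¹]≡y B≢0 (s - A)))
          (solve 4 (λ A B B⁻¹ s → B :* ((s :- A) :* B⁻¹) := B :* (:- (A :* B⁻¹) :+ B⁻¹ :* s)) refl A B (B ⁻¹) s)
    anchored : B ≡ 1# ⊎ Slope (fixedPoint A B)
    anchored with B ≟ 1#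
    ... | yes B≡1 = inj₁ B≡1
    ... | no  B≢1 = inj₂ (direction⇒slope (1-l≢0 B≢1)
      (subst IsDirection (⊖x-fixedPoint z B≢1) (proj₂ (Adj-sym (Cz x (inj₁ refl) (z≢x ∘ sym))))))

  good-adjacent : ∀ {u v} → Good u → Good v → u ≢ v → Adj D u v
  good-adjacent {u} {v} (σ , anchored) (σ′ , anchored′) u≢v with Bc u ≟ Bc v
  ... | yes B≡B′ = u≢v , i , A′ - A , (begin
    v ⊖ u                   ≡⟨ ⊖-coords u v ⟩
    vec (A′ - A) (B′ - B)   ≡⟨ cong (vec (A′ - A)) (trans (cong (λ b → B′ - b) B≡B′) (-‿inverseʳ B′)) ⟩
    vec (A′ - A) 0#         ≡⟨ vec-d (A′ - A) ⟩
    (A′ - A) · d            ∎)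
    where
    open ≡-Reasoning
    A = Ac u ; B = Bc u ; A′ = Ac v ; B′ = Bc v
  ... | no B≢B′ = u≢v , subst IsDirection (begin
    vec ((B - B′) * R) (- (B - B′))   ≡⟨ cong₂ vec first (solve 2 (λ B B′ → :- (B :- B′) := B′ :- B) refl B B′) ⟩
    vec (A′ - A) (B′ - B)             ≡⟨ ⊖-coords u v ⟨
    v ⊖ u                             ∎) (slope⇒direction (B - B′) (agreementPoint∈U σ σ′ anchored anchored′ B≢B′))
    where
    open ≡-Reasoning
    A = Ac u ; B = Bc u ; A′ = Ac v ; B′ = Bc v
    R = (A - A′) * (B′ - B) ⁻¹
    first : (B - B′) * R ≡ A′ - A
    first = trans (solve 5 (λ A A′ B B′ κ → (B :- B′) :* ((A :- A′) :* κ) := (B′ :- B) :* ((A′ :- A) :* κ))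
                           refl A A′ B B′ ((B′ - B) ⁻¹))
                  (x*[y*x⁻¹]≡y (B≢B′ ∘ sym ∘ x-y≡0⇒x≡y) (A′ - A))

  C-clique : IsClique D C
  C-clique u v Cu Cv u≢v with Star? u | Star? v
  ... | yes Star-u | _          = Adj-sym (Cv u Star-u u≢v)
  ... | no _       | yes Star-v = Cu v Star-v (u≢v ∘ sym)
  ... | no ¬Star-u | no ¬Star-v = good-adjacent (good Cu u∉L u≢x) (good Cv v∉L v≢x) u≢v
    where
    u∉L = proj₁ (C∖Star Cu ¬Star-u)
    u≢x = proj₂ (C∖Star Cu ¬Star-u)
    v∉L = proj₁ (C∖Star Cv ¬Star-v)
    v≢x = proj₂ (C∖Star Cv ¬Star-v)

  slopeOf : Fin (suc m′) → Carrier
  slopeOf j = α (dir j) * (- β (dir j)) ⁻¹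

  module _ {j} (i≢j : i ≢ j) where

    -β≢0 : - β (dir j) ≢ 0#
    -β≢0 -β≡0 = dir-distinct i j i≢j (α (dir j) , (begin
      dir j                         ≡⟨ vec-αβ (dir j) ⟨
      vec (α (dir j)) (β (dir j))   ≡⟨ cong (vec (α (dir j))) (-x≡0⇒x≡0 -β≡0) ⟩
      vec (α (dir j)) 0#            ≡⟨ vec-d (α (dir j)) ⟩
      α (dir j) · d                 ∎))
      where open ≡-Reasoning

    dir≡·slopeOf : dir j ≡ (- β (dir j)) · vec (slopeOf j) (- 1#)
    dir≡·slopeOf = begin
      dir j                         ≡⟨ vec-αβ (dir j) ⟨
      vec (α (dir j)) (β (dir j))   ≡⟨ cong₂ vec (sym (x*[y*x⁻¹]≡y -β≢0 _)) (sym (-‿involutive _)) ⟩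
      vec (c * slopeOf j) (- c)     ≡⟨ ·-slope c (slopeOf j) ⟨
      c · vec (slopeOf j) (- 1#)    ∎
      where
      open ≡-Reasoning
      c = - β (dir j)

    vec-slopeOf : vec (slopeOf j) (- 1#) ≡ (- β (dir j)) ⁻¹ · dir j
    vec-slopeOf = trans (sym (⁻¹·-cancel -β≢0 _)) (cong ((- β (dir j)) ⁻¹ ·_) (sym dir≡·slopeOf))

    slopeOf-slope : Slope (slopeOf j)
    slopeOf-slope = j , _ , vec-slopeOf

  slope⇒slopeOf : ∀ {s} → Slope s → Σ (Fin (suc m′)) λ j → i ≢ j × slopeOf j ≡ s
  slope⇒slopeOf {s} (j , t , vec≡t·dir) = j , i≢j , sym (begin
    s                   ≡⟨ proj₁ coefficients ⟩
    t * c * slopeOf j   ≡⟨ cong (_* slopeOf j) t*c≡1 ⟩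
    1# * slopeOf j      ≡⟨ *-identityˡ _ ⟩
    slopeOf j           ∎)
    where
    open ≡-Reasoning
    i≢j : i ≢ j
    i≢j refl = 1≢0 (-x≡0⇒x≡0 (proj₂ (vec-injective (trans vec≡t·dir (sym (vec-d t))))))
    c = - β (dir j)
    coefficients = vec-injective (begin
      vec s (- 1#)                             ≡⟨ vec≡t·dir ⟩
      t · dir j                                ≡⟨ cong (t ·_) (dir≡·slopeOf i≢j) ⟩
      t · (c · vec (slopeOf j) (- 1#))         ≡⟨ ·-assoc t c _ ⟩
      (t * c) · vec (slopeOf j) (- 1#)         ≡⟨ ·-vec (t * c) (slopeOf j) (- 1#) ⟩
      vec (t * c * slopeOf j) (t * c * - 1#)   ∎)
    t*c≡1 : t * c ≡ 1#
    t*c≡1 = sym (trans (sym (-‿involutive 1#)) (trans (cong -_ (proj₂ coefficients))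
      (solve 1 (λ x → :- (x :* :- con 1ℤ) := x) refl (t * c))))

  slopeOf-injective : ∀ {j j′} → i ≢ j → i ≢ j′ → slopeOf j ≡ slopeOf j′ → j ≡ j′
  slopeOf-injective {j} {j′} i≢j i≢j′ same-slope with j Fin.≟ j′
  ... | yes j≡j′ = j≡j′
  ... | no  j≢j′ = ⊥-elim (dir-distinct j j′ j≢j′ (c′ * c ⁻¹ , (begin
    dir j′                         ≡⟨ dir≡·slopeOf i≢j′ ⟩
    c′ · vec (slopeOf j′) (- 1#)   ≡⟨ cong (λ s → c′ · vec s (- 1#)) (sym same-slope) ⟩
    c′ · vec (slopeOf j) (- 1#)    ≡⟨ cong (c′ ·_) (vec-slopeOf i≢j) ⟩
    c′ · (c ⁻¹ · dir j)            ≡⟨ ·-assoc c′ (c ⁻¹) (dir j) ⟩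
    (c′ * c ⁻¹) · dir j            ∎)))
    where
    open ≡-Reasoning
    c = - β (dir j)
    c′ = - β (dir j′)

  slopes : Fin m′ → Carrier
  slopes k = slopeOf (punchIn i k)

  slopes-injective : Injective _≡_ _≡_ slopes
  slopes-injective {k} {l} = Fin.punchIn-injective i k l ∘ slopeOf-injective (punchInᵢ≢i k) (punchInᵢ≢i l)
    where
    punchInᵢ≢i : ∀ k → i ≢ punchIn i k
    punchInᵢ≢i k = Fin.punchInᵢ≢i i k ∘ sym

  slopes-enumerate : ∀ {s} → Slope s → ∃ λ k → slopes k ≡ s
  slopes-enumerate = enumerate ∘ slope⇒slopeOf
    where
    enumerate : ∀ {s} → Σ (Fin (suc m′)) (λ j → i ≢ j × slopeOf j ≡ s) → ∃ λ k → slopes k ≡ s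
    enumerate (j , i≢j , slopeOf-j≡s) =
      punchOut i≢j , trans (cong slopeOf (Fin.punchIn-punchOut i≢j)) slopeOf-j≡s

  slopes-slope : ∀ k → Slope (slopes k)
  slopes-slope k = slopeOf-slope (Fin.punchInᵢ≢i i k ∘ sym)

  C-maximal : IsMaximalClique D C
  C-maximal = CommonNeighbourhood-maximal Star-clique C-clique

  Star⊆C : Star ⊆ C
  Star⊆C = ⊆CommonNeighbourhood Star-clique

  C-unique : ∀ C′ → IsMaximalClique D C′ → Star ⊆ C′ → _≐_ D C′ C
  C-unique = CommonNeighbourhood-unique Star-clique C-clique

  module _ (m′≢0 : m′ ×′ 1# ≢ 0#) where
    open Enumerated slopes-injective slopes-enumerate slopes-slope m′≢0

    good⇒B≢1 : ∀ {z} → Good z → z ≢ x → Bc z ≢ 1#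
    good⇒B≢1 {z} (σ , _) z≢x B≡1 = z≢x (begin
      z                     ≡⟨ point-coords z ⟨
      point (Ac z) (Bc z)   ≡⟨ cong₂ point (translation-stabiliser-trivial (subst (Stabilises (Ac z)) B≡1 σ)) B≡1 ⟩
      point 0# 1#           ≡⟨ x≡point01 ⟨
      x                     ∎)
      where open ≡-Reasoning

    good⇒fixedPoint-slope : ∀ {z} → Good z → z ≢ x → Slope (fixedPoint (Ac z) (Bc z))
    good⇒fixedPoint-slope G@(_ , anchored) z≢x = [ ⊥-elim ∘ good⇒B≢1 G z≢x , id ]′ anchored

    module _ {z} (Cz : C z) (z∉L : ¬ OnLine D L z) (z≢x : z ≢ x) where

      private
        Gz = good Cz z∉L z≢x
        slope-z = good⇒fixedPoint-slope Gz z≢x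

      M : Line D
      M = line x (proj₁ slope-z)

      good⇒onM : ∀ {c} → Good c → c ≢ x → OnLine D M c
      good⇒onM {c} Gc c≢x = ⊖-onLine (begin
        c ⊖ x                                    ≡⟨ ⊖x-fixedPoint c (good⇒B≢1 Gc c≢x) ⟩
        vec ((1# - Bc c) * Qc) (- (1# - Bc c))   ≡⟨ ·-slope (1# - Bc c) Qc ⟨
        (1# - Bc c) · vec Qc (- 1#)              ≡⟨ cong (λ q → (1# - Bc c) · vec q (- 1#)) Qc≡Qz ⟩
        (1# - Bc c) · vec Qz (- 1#)              ≡⟨ cong ((1# - Bc c) ·_) (proj₂ (proj₂ slope-z)) ⟩
        (1# - Bc c) · (t · dir j)                ≡⟨ ·-assoc (1# - Bc c) t (dir j) ⟩
        ((1# - Bc c) * t) · dir j                ∎)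
        where
        open ≡-Reasoning
        j = proj₁ slope-z
        t = proj₁ (proj₂ slope-z)
        Qc = fixedPoint (Ac c) (Bc c)
        Qz = fixedPoint (Ac z) (Bc z)
        Qc≡Qz = fixedPoints-equal (proj₁ Gc) (proj₁ Gz) (good⇒B≢1 Gc c≢x) (good⇒B≢1 Gz z≢x)

      C⊆L∪M : C ⊆ OnLine D L ∪ OnLine D M
      C⊆L∪M {c} Cc = by-cases (onLine? L c) (c ≟ₚ x)
        where
        by-cases : Dec (OnLine D L c) → Dec (c ≡ x) → (OnLine D L ∪ OnLine D M) c
        by-cases (yes c∈L) _          = inj₁ c∈L
        by-cases (no _)    (yes refl) = inj₂ (onLine-base x _)
        by-cases (no c∉L)  (no c≢x)   = inj₂ (good⇒onM (good Cc c∉L c≢x) c≢x)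

      M-unique : ∀ M′ → OnLine D M′ x → C ⊆ OnLine D L ∪ OnLine D M′ → _≐_ D (OnLine D M′) (OnLine D M)
      M-unique M′ x∈M′ C⊆L∪M′ =
        line-determined x≢z x∈M′ z∈M′ x∈M z∈M , line-determined x≢z x∈M z∈M x∈M′ z∈M′
        where
        x≢z = z≢x ∘ sym
        x∈M = onLine-base x (proj₁ slope-z)
        z∈M = good⇒onM Gz z≢x
        z∈M′ = [ ⊥-elim ∘ z∉L , id ]′ (C⊆L∪M′ Cz)

    C-in-two-lines : ¬ IsMaximalClique D Star →
      Σ (Line D) λ M → OnLine D M x × (C ⊆ (OnLine D L ∪ OnLine D M))
        × (∀ M′ → OnLine D M′ x → C ⊆ (OnLine D L ∪ OnLine D M′) → _≐_ D (OnLine D M′) (OnLine D M))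
    C-in-two-lines ¬maximal with z , Cz , ¬Star-z ← outside-neighbour Star-clique Star? ¬maximal
      with z∉L , z≢x ← C∖Star Cz ¬Star-z =
      M Cz z∉L z≢x , onLine-base x _ , C⊆L∪M Cz z∉L z≢x , M-unique Cz z∉L z≢x

theorem3 : (p k : ℕ) → Prime p → (K : FiniteField) → FiniteField.order K ≡ p ^ k →
    (m : ℕ) → m ≥ 1 → (D : Net.Directions K m) →
    (L : Net.Line K D) → (x : Net.Point K) → ¬ Net.OnLine K D L x →
    (Σ (Pred (Net.Point K) 0ℓ) λ C →
        (Net.IsMaximalClique K D C × (Net.StarOn K D x L ⊆ C))
        × (∀ C′ → Net.IsMaximalClique K D C′ → Net.StarOn K D x L ⊆ C′ → Net._≐_ K D C′ C)
      × (¬ (p ∣ (m ∸ 1)) → ¬ Net.IsMaximalClique K D (Net.StarOn K D x L) →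
          Σ (Net.Line K D) λ M → Net.OnLine K D M x × (C ⊆ (Net.OnLine K D L ∪ Net.OnLine K D M))
            × (∀ M′ → Net.OnLine K D M′ x → C ⊆ (Net.OnLine K D L ∪ Net.OnLine K D M′) →
                Net._≐_ K D (Net.OnLine K D M′) (Net.OnLine K D M))))
theorem3 p k p-prime K order≡pᵏ (suc m′) _ D (Net.line a i) x x∉L =
  C , (C-maximal , Star⊆C) , C-unique ,
  λ p∤m′ → C-in-two-lines (Characteristic.order-prime-power⇒×1≢0 K {k = k} p-prime order≡pᵏ p∤m′)
  where open Frame K D a i x x∉L
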